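{- Let $a,b$ be positive integers, and let $\preceq_{sd}$ be the strong dominance partial ordering of $[a]\times [b]$. Then the maximum size of an antichain in $([a]\times [b],\preceq_{sd})$ is equal to $a+b-1$.
   Context: $[k]=\{1,\dots,k\}$. For $S\subseteq\mathbb R^d$, the strong dominance partial order $\preceq_{sd}$ on $S$ is defined by $u\preceq_{sd} v$ iff $u=v$ or every coordinate of $v$ is strictly greater than the corresponding coordinate of $u$. -}

module Defs where

open import Data.Nat using (ℕ; _<_)
open import Data.Fin using (Fin; toℕ)
open import Data.Product using (_×_; proj₁; proj₂)
open import Data.Sum using (_⊎_)
open import Data.List using (List)
open import Data.List.Relation.Unary.Unique.Propositional using (Unique)
open import Data.List.Membership.Propositional using (_∈_)
open import Relation.Binary.PropositionalEquality using (_≡_; _≢_)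
open import Relation.Nullary using (¬_)

-- The grid [a] × [b]; Fin a is {0,…,a-1}, order-isomorphic to [a] = {1,…,a}.
Grid : ℕ → ℕ → Set
Grid a b = Fin a × Fin b

_⪯sd_ : {a b : ℕ} → Grid a b → Grid a b → Set
u ⪯sd v = (u ≡ v) ⊎ ((toℕ (proj₁ u) < toℕ (proj₁ v)) × (toℕ (proj₂ u) < toℕ (proj₂ v)))

record IsAntichain {a b : ℕ} (xs : List (Grid a b)) : Set where
  field
    unique       : Unique xs
    incomparable : ∀ {u v} → u ∈ xs → v ∈ xs → u ≢ v → ¬ (u ⪯sd v)

-- Upper bound: the grid is covered by the a + b − 1 diagonals {(i , j) : i − j = c},
-- each of which is a chain, so an antichain meets every diagonal at most once.
-- Lower bound: the hook formed by the first row and the first column is an antichain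
-- of size a + b − 1, since a point with a zero coordinate strictly dominates nothing.
module Submission where

open import Defs
open import Data.Nat using (ℕ; suc; s<s; _+_; _∸_; _≤_; _<_; _<?_)
open import Data.Nat.Properties
  using (≮⇒≥; <-irrefl; <-cmp; n≮0; ≤-pred; +-mono-≤-<; m∸n≤m; +-assoc; m∸n+n≡m; +-cancelˡ-<; +-cancelˡ-≡; +-monoˡ-<; +-suc; module ≤-Reasoning)
open import Data.Fin as Fin using (Fin; toℕ; fromℕ<)
open import Data.Fin.Properties using (pigeonhole; toℕ-injective; toℕ<n; fromℕ<-injective; suc-injective)
open import Data.List using (List; length; lookup; map; _++_; allFin)
open import Data.List.Properties using (length-++; length-map; length-tabulate)
open import Data.List.Relation.Unary.All as All using (All)
import Data.List.Relation.Unary.All.Properties as All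
open import Data.List.Relation.Unary.AllPairs using (AllPairs; []; _∷_)
open import Data.List.Relation.Unary.Unique.Propositional using (Unique)
import Data.List.Relation.Unary.Unique.Propositional.Properties as Unique
open import Data.List.Membership.Propositional using (_∈_)
open import Data.List.Membership.Propositional.Properties using (∈-map⁻; ∈-lookup)
open import Data.Product using (Σ; _×_; _,_; proj₁; proj₂)
open import Data.Sum using (_⊎_; inj₁; inj₂)
open import Function using (_∘_)
open import Relation.Binary.Definitions using (tri<; tri≈; tri>)
open import Relation.Binary.PropositionalEquality
open import Relation.Nullary using (¬_; yes; no; contradiction)

private
  variable
    A : Set

lookup-AllPairs : ∀ {R : A → A → Set} {xs : List A} → AllPairs R xs →
                  ∀ {i j} → i Fin.< j → R (lookup xs i) (lookup xs j)
lookup-AllPairs (r ∷ _)  {Fin.zero}  {Fin.suc j} _         = All.lookup r (∈-lookup j)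
lookup-AllPairs (_ ∷ rs) {Fin.suc i} {Fin.suc j} (s<s i<j) = lookup-AllPairs rs i<j

length≤-if-injectiveOn : ∀ {n} (key : A → Fin n) {xs : List A} → Unique xs →
                         (∀ {x y} → x ∈ xs → y ∈ xs → key x ≡ key y → x ≡ y) →
                         length xs ≤ n
length≤-if-injectiveOn {n = n} key {xs} unique injective with n <? length xs
... | no  n≮len = ≮⇒≥ n≮len
... | yes n<len with i , j , i<j , same ← pigeonhole n<len (key ∘ lookup xs)
  = contradiction (injective (∈-lookup i) (∈-lookup j) same) (lookup-AllPairs unique i<j)

module _ {a b : ℕ} where

  OnAxes : Grid a b → Set
  OnAxes (i , j) = toℕ i ≡ 0 ⊎ toℕ j ≡ 0

  ⪯sd-OnAxes⇒≡ : ∀ {u v : Grid a b} → OnAxes v → u ⪯sd v → u ≡ v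
  ⪯sd-OnAxes⇒≡ _                          (inj₁ u≡v)          = u≡v
  ⪯sd-OnAxes⇒≡ {v = _ , _} (inj₁ row≡0) (inj₂ (row< , _)) = contradiction (subst (_ <_) row≡0 row<) n≮0
  ⪯sd-OnAxes⇒≡ {v = _ , _} (inj₂ col≡0) (inj₂ (_ , col<)) = contradiction (subst (_ <_) col≡0 col<) n≮0

  OnAxes⇒IsAntichain : ∀ {xs : List (Grid a b)} → Unique xs → All OnAxes xs → IsAntichain xs
  OnAxes⇒IsAntichain unique onAxes = record
    { unique       = unique
    ; incomparable = λ _ v∈xs u≢v u⪯v → u≢v (⪯sd-OnAxes⇒≡ (All.lookup onAxes v∈xs) u⪯v)
    }

  IsAntichain-comparable⇒≡ : ∀ {xs : List (Grid a b)} {u v} → IsAntichain xs →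
                             u ∈ xs → v ∈ xs → u ⪯sd v → u ≡ v
  IsAntichain-comparable⇒≡ _  _   _   (inj₁ u≡v) = u≡v
  IsAntichain-comparable⇒≡ ac u∈xs v∈xs u⪯v@(inj₂ (row< , _)) =
    contradiction u⪯v (IsAntichain.incomparable ac u∈xs v∈xs λ { refl → <-irrefl refl row< })

module _ {a b : ℕ} where

  diagonal : Grid (suc a) (suc b) → ℕ
  diagonal (i , j) = toℕ i + (b ∸ toℕ j)

  diagonal<a+b : ∀ u → diagonal u < a + suc b
  diagonal<a+b (i , j) = +-mono-≤-< (≤-pred (toℕ<n i)) (s<s (m∸n≤m b (toℕ j)))

  diagonal-+-col : ∀ u → diagonal u + toℕ (proj₂ u) ≡ toℕ (proj₁ u) + b
  diagonal-+-col (i , j) = begin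
    toℕ i + (b ∸ toℕ j) + toℕ j   ≡⟨ +-assoc (toℕ i) _ _ ⟩
    toℕ i + (b ∸ toℕ j + toℕ j)   ≡⟨ cong (toℕ i +_) (m∸n+n≡m (≤-pred (toℕ<n j))) ⟩
    toℕ i + b                     ∎
    where open ≡-Reasoning

  module _ {u v : Grid (suc a) (suc b)} (same : diagonal u ≡ diagonal v) where

    private
      shift : diagonal u + toℕ (proj₂ v) ≡ toℕ (proj₁ v) + b
      shift = trans (cong (_+ toℕ (proj₂ v)) same) (diagonal-+-col v)

    same-diagonal-< : toℕ (proj₁ u) < toℕ (proj₁ v) → toℕ (proj₂ u) < toℕ (proj₂ v)
    same-diagonal-< row< = +-cancelˡ-< (diagonal u) _ _ (begin-strict
      diagonal u + toℕ (proj₂ u)   ≡⟨ diagonal-+-col u ⟩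
      toℕ (proj₁ u) + b            <⟨ +-monoˡ-< b row< ⟩
      toℕ (proj₁ v) + b            ≡⟨ shift ⟨
      diagonal u + toℕ (proj₂ v)   ∎)
      where open ≤-Reasoning

    same-diagonal-≡ : toℕ (proj₁ u) ≡ toℕ (proj₁ v) → u ≡ v
    same-diagonal-≡ row≡ = cong₂ _,_ (toℕ-injective row≡) (toℕ-injective (+-cancelˡ-≡ (diagonal u) _ _ (begin
      diagonal u + toℕ (proj₂ u)   ≡⟨ diagonal-+-col u ⟩
      toℕ (proj₁ u) + b            ≡⟨ cong (_+ b) row≡ ⟩
      toℕ (proj₁ v) + b            ≡⟨ shift ⟨
      diagonal u + toℕ (proj₂ v)   ∎)))
      where open ≡-Reasoning

  same-diagonal⇒comparable : ∀ {u v : Grid (suc a) (suc b)} → diagonal u ≡ diagonal v →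
                             u ⪯sd v ⊎ v ⪯sd u
  same-diagonal⇒comparable {u} {v} same with <-cmp (toℕ (proj₁ u)) (toℕ (proj₁ v))
  ... | tri< row< _ _ = inj₁ (inj₂ (row< , same-diagonal-< same row<))
  ... | tri≈ _ row≡ _ = inj₁ (inj₁ (same-diagonal-≡ same row≡))
  ... | tri> _ _ row> = inj₂ (inj₂ (row> , same-diagonal-< (sym same) row>))

  IsAntichain⇒length≤ : ∀ {xs : List (Grid (suc a) (suc b))} → IsAntichain xs →
                        length xs ≤ a + suc b
  IsAntichain⇒length≤ {xs} ac = length≤-if-injectiveOn diagonalIndex (IsAntichain.unique ac) injective
    where
      diagonalIndex : Grid (suc a) (suc b) → Fin (a + suc b)
      diagonalIndex u = fromℕ< (diagonal<a+b u)

      injective : ∀ {u v} → u ∈ xs → v ∈ xs → diagonalIndex u ≡ diagonalIndex v → u ≡ v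
      injective {u} {v} u∈xs v∈xs same
        with same-diagonal⇒comparable (fromℕ<-injective _ _ (diagonal<a+b u) (diagonal<a+b v) same)
      ... | inj₁ u⪯v = IsAntichain-comparable⇒≡ ac u∈xs v∈xs u⪯v
      ... | inj₂ v⪯u = sym (IsAntichain-comparable⇒≡ ac v∈xs u∈xs v⪯u)

  columnPoint : Fin (suc a) → Grid (suc a) (suc b)
  columnPoint i = i , Fin.zero

  rowPoint : Fin b → Grid (suc a) (suc b)
  rowPoint j = Fin.zero , Fin.suc j

  firstColumn : List (Grid (suc a) (suc b))
  firstColumn = map columnPoint (allFin (suc a))

  firstRowWithoutCorner : List (Grid (suc a) (suc b))
  firstRowWithoutCorner = map rowPoint (allFin b)

  hook : List (Grid (suc a) (suc b))
  hook = firstColumn ++ firstRowWithoutCorner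

  hook-unique : Unique hook
  hook-unique = Unique.++⁺ {xs = firstColumn} (Unique.map⁺ (cong proj₁) (Unique.allFin⁺ (suc a)))
                           (Unique.map⁺ (suc-injective ∘ cong proj₂) (Unique.allFin⁺ b))
                           disjoint
    where
      disjoint : ∀ {u} → ¬ (u ∈ firstColumn × u ∈ firstRowWithoutCorner)
      disjoint (u∈col , u∈row) with ∈-map⁻ columnPoint u∈col | ∈-map⁻ rowPoint u∈row
      ... | _ , _ , refl | _ , _ , ()

  hook-OnAxes : All OnAxes hook
  hook-OnAxes = All.++⁺ {xs = firstColumn} (All.map⁺ (All.universal (λ _ → inj₂ refl) _))
                        (All.map⁺ (All.universal (λ _ → inj₁ refl) _))

  length-hook : length hook ≡ a + suc b
  length-hook = begin
    length hook                                           ≡⟨ length-++ firstColumn ⟩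
    length firstColumn + length firstRowWithoutCorner     ≡⟨ cong₂ _+_ (length-map columnPoint (allFin (suc a))) (length-map rowPoint (allFin b)) ⟩
    length (allFin (suc a)) + length (allFin b)           ≡⟨ cong₂ _+_ (length-tabulate {n = suc a} (λ i → i)) (length-tabulate {n = b} (λ i → i)) ⟩
    suc a + b                                             ≡⟨ +-suc a b ⟨
    a + suc b                                             ∎
    where open ≡-Reasoning

lemma8 : (a b : ℕ) → 1 ≤ a → 1 ≤ b →
    (Σ (List (Grid a b)) (λ xs → IsAntichain xs × length xs ≡ a + b ∸ 1))
    × (∀ (xs : List (Grid a b)) → IsAntichain xs → length xs ≤ a + b ∸ 1)
lemma8 (suc a) (suc b) _ _ =
  (hook , OnAxes⇒IsAntichain hook-unique hook-OnAxes , length-hook) ,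
  λ _ → IsAntichain⇒length≤
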